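{- For every integer $n>0$ there exists a universal Lyndon word of degree $n$.
   Context: $\Sigma_n=\{1,\ldots,n\}$. For a word $w=a_1\cdots a_m$ its conjugates are $w_i=a_i\cdots a_m a_1\cdots a_{i-1}$; a proper conjugate is $w_2w_1$ where $w=w_1w_2$ with $w_1,w_2$ nonempty. A total order on the alphabet induces the usual lexicographic order on words ($u$ is smaller than $v$ if $u$ is a proper prefix of $v$, or $u=zau'$, $v=zbv'$ with letters $a<b$). A word $w$ over $\Sigma_n$ is a Lyndon word if there is a total order on $\Sigma_n$ for which $w$ is strictly lexicographically smaller than each of its proper conjugates. A universal Lyndon word of degree $n$ is a word over $\Sigma_n$ of length $n!$ all of whose conjugates are Lyndon words. -}

module Defs where

open import Data.Nat using (ℕ; suc; _<_; _!)

open import Data.Fin using (Fin; toℕ)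
open import Data.List using (List; []; _∷_; _++_; length; drop; take)
open import Data.Product using (Σ; ∃; _×_; _,_)
open import Function.Bundles using (_↔_; Inverse)
open import Relation.Binary.PropositionalEquality using (_≡_)

-- The alphabet Σ_n = {1,…,n} is represented by Fin n (letters 0,…,n-1).
Word : ℕ → Set
Word n = List (Fin n)

-- A total order on the finite set Fin n is represented by a ranking
-- bijection ρ : Fin n ↔ Fin n ; letter a is below letter b iff
-- rank a < rank b.  (Every strict total order on a finite set of
-- size n is of this form for exactly one ρ.)
Order : ℕ → Set
Order n = Fin n ↔ Fin n

_≺[_]_ : ∀ {n} → Fin n → Order n → Fin n → Set
a ≺[ ρ ] b = toℕ (Inverse.to ρ a) < toℕ (Inverse.to ρ b)

data LexLt {n} (ρ : Order n) : Word n → Word n → Set where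
  prefix : ∀ {b v} → LexLt ρ [] (b ∷ v)
  here   : ∀ {a b u v} → a ≺[ ρ ] b → LexLt ρ (a ∷ u) (b ∷ v)
  there  : ∀ {a u v} → LexLt ρ u v → LexLt ρ (a ∷ u) (a ∷ v)

SmallerThanProperConjugates : ∀ {n} → Order n → Word n → Set
SmallerThanProperConjugates {n} ρ w =
  ∀ (a : Fin n) (w₁ : Word n) (b : Fin n) (w₂ : Word n) →
  w ≡ (a ∷ w₁) ++ (b ∷ w₂) → LexLt ρ w ((b ∷ w₂) ++ (a ∷ w₁))

IsLyndon : ∀ {n} → Word n → Set
IsLyndon {n} w = Σ (Order n) λ ρ → SmallerThanProperConjugates ρ w

-- The conjugates of w = a₁⋯aₘ are wᵢ = aᵢ⋯aₘa₁⋯aᵢ₋₁ for i = 1,…,m;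
-- here indexed by i = 0,…,m-1 as drop i w ++ take i w.
conjugate : ∀ {n} → Word n → ℕ → Word n
conjugate w i = drop i w ++ take i w

IsUniversalLyndon : (n : ℕ) → Word n → Set
IsUniversalLyndon n w =
  (length w ≡ n !) × (∀ i → i < length w → IsLyndon (conjugate w i))

-- Let w be a cyclic word of length n! over n letters in which every factor of length n - 1,
-- completed by the letter it misses, is a permutation, the n! permutations being distinct (a
-- shorthand universal cycle for permutations).  The conjugate of w starting at i is Lyndon for the
-- order ranking the letters as in the permutation at i: it begins with the letters of ranks
-- 0, …, n - 2 in increasing order, and any other conjugate departs from it within these n - 1
-- letters (distinct permutations differ in two places), necessarily upwards since the lower ranks
-- are used up.  Such cycles exist for every n: if π₀, π₁, … are the permutations of one over n - 1
-- letters, the blocks new ∷ πᵢ concatenate to one over n letters, because two of its windows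
-- either place the new letter at different offsets or copy two distinct πᵢ.
module Submission where

open import Defs
open import Data.Empty using (⊥-elim)
open import Data.Fin using (Fin; toℕ; fromℕ; fromℕ<; inject₁; punchOut) renaming (zero to fzero)
open import Data.Fin.Properties
  using ( toℕ-injective; toℕ<n; toℕ-fromℕ<; any?; injective⇒≤; punchOut-injective
        ; fromℕ≢inject₁; inject₁-injective)
  renaming (_≟_ to _≟ᶠ_)
open import Data.List using (List; []; _∷_; _++_; length; take; drop; applyUpTo)
open import Data.List.Properties
  using (∷-injective; length-++; length-applyUpTo; length-take; take++drop≡id)
open import Data.Nat
  using (ℕ; zero; suc; _+_; _*_; _∸_; _⊓_; _≤_; _<_; z≤n; s≤s; s≤s⁻¹; z<s; s<s; _!; _<?_; _≤?_; _≟_)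
open import Data.Nat.Properties
open import Data.Nat.DivMod
  using (_/_; _%_; m≡m%n+[m/n]*n; m%n<n; [m+kn]%n≡m%n; m<n⇒m%n≡m; m<n⇒m/n≡0; m*n/n≡m; +-distrib-/-∣ʳ)
open import Data.Nat.Divisibility using (n∣m*n)
open import Algebra.Properties.CommutativeSemigroup +-commutativeSemigroup using (xy∙z≈xz∙y)
open import Data.Product using (Σ; ∃-syntax; _×_; _,_; proj₁; proj₂)
open import Function using (_∘_)
open import Function.Bundles using (Inverse; mk↔ₛ′)
open import Function.Definitions using (Injective)
open import Relation.Binary.Definitions using (Tri; tri<; tri≈; tri>)
open import Relation.Binary.PropositionalEquality
open import Relation.Nullary using (Dec; yes; no; contradiction)

Periodic : {A : Set} → ℕ → (ℕ → A) → Set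
Periodic N f = ∀ x → f (x + N) ≡ f x

periodic-shift : ∀ {A : Set} {N} {f : ℕ → A} → Periodic N f → ∀ a → Periodic N (f ∘ (a +_))
periodic-shift {f = f} f-per a x = trans (cong f (sym (+-assoc a x _))) (f-per (a + x))

m+n≡o+p⇒n<o⇒p<m : ∀ {m n o p} → m + n ≡ o + p → n < o → p < m
m+n≡o+p⇒n<o⇒p<m {m} {n} {o} {p} eq n<o =
  +-cancelˡ-< o p m (subst (_< o + m) eq (subst (m + n <_) (+-comm m o) (+-monoʳ-< m n<o)))

applyUpTo-cong : ∀ {A : Set} {f g : ℕ → A} → f ≗ g → ∀ n → applyUpTo f n ≡ applyUpTo g n
applyUpTo-cong f≗g zero    = refl
applyUpTo-cong f≗g (suc n) = cong₂ _∷_ (f≗g 0) (applyUpTo-cong (f≗g ∘ suc) n)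

applyUpTo-++ : ∀ {A : Set} (f : ℕ → A) k l →
               applyUpTo f (k + l) ≡ applyUpTo f k ++ applyUpTo (f ∘ (k +_)) l
applyUpTo-++ f zero    l = refl
applyUpTo-++ f (suc k) l = cong (f 0 ∷_) (applyUpTo-++ (f ∘ suc) k l)

++-injective : ∀ {A : Set} (xs us : List A) {ys vs} →
               length xs ≡ length us → xs ++ ys ≡ us ++ vs → xs ≡ us × ys ≡ vs
++-injective []       []       _   eq = refl , eq
++-injective (x ∷ xs) (u ∷ us) len eq with refl , eq′ ← ∷-injective eq
  with refl , refl ← ++-injective xs us (suc-injective len) eq′ = refl , refl

rotate-applyUpTo : ∀ {A : Set} {N} {f : ℕ → A} → Periodic N f → ∀ xs ys →
                   applyUpTo f N ≡ xs ++ ys → ys ++ xs ≡ applyUpTo (f ∘ (length xs +_)) N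
rotate-applyUpTo {A} {N} {f} f-per xs ys eq = begin
  ys ++ xs                                          ≡⟨ cong₂ _++_ ys≡ xs≡ ⟩
  applyUpTo g l ++ applyUpTo f j                    ≡⟨ cong (applyUpTo g l ++_) (applyUpTo-cong wrap j) ⟩
  applyUpTo g l ++ applyUpTo (g ∘ (l +_)) j         ≡⟨ applyUpTo-++ g l j ⟨
  applyUpTo g (l + j)                               ≡⟨ cong (applyUpTo g) (trans (+-comm l j) j+l≡N) ⟩
  applyUpTo g N                                     ∎
  where
  open ≡-Reasoning
  j : ℕ
  j = length xs
  l : ℕ
  l = length ys
  g : ℕ → A
  g = f ∘ (j +_)
  j+l≡N : j + l ≡ N
  j+l≡N = trans (sym (length-++ xs)) (trans (cong length (sym eq)) (length-applyUpTo f N))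
  split : xs ++ ys ≡ applyUpTo f j ++ applyUpTo g l
  split = trans (sym eq) (trans (cong (applyUpTo f) (sym j+l≡N)) (applyUpTo-++ f j l))
  xs≡ : xs ≡ applyUpTo f j
  xs≡ = proj₁ (++-injective xs _ (sym (length-applyUpTo f j)) split)
  ys≡ : ys ≡ applyUpTo g l
  ys≡ = proj₂ (++-injective xs _ (sym (length-applyUpTo f j)) split)
  wrap : f ≗ g ∘ (l +_)
  wrap t = sym (trans (cong f (trans (sym (+-assoc j l t)) (trans (cong (_+ t) j+l≡N) (+-comm N t))))
                      (f-per t))

conjugate-applyUpTo : ∀ {n N} {f : ℕ → Fin n} → Periodic N f → ∀ {i} → i ≤ N →
                      conjugate (applyUpTo f N) i ≡ applyUpTo (f ∘ (i +_)) N
conjugate-applyUpTo {n} {N} {f} f-per {i} i≤N =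
  trans (rotate-applyUpTo f-per (take i w) (drop i w) (sym (take++drop≡id i w)))
        (cong (λ k → applyUpTo (f ∘ (k +_)) N) length-prefix)
  where
  w : List (Fin n)
  w = applyUpTo f N
  length-prefix : length (take i w) ≡ i
  length-prefix = trans (length-take i w) (trans (cong (i ⊓_) (length-applyUpTo f N)) (m≤n⇒m⊓n≡m i≤N))

applyUpTo-LexLt : ∀ {n} (ρ : Order n) {f g : ℕ → Fin n} {K t} → t < K →
                  (∀ {s} → s < t → f s ≡ g s) → f t ≺[ ρ ] g t →
                  LexLt ρ (applyUpTo f K) (applyUpTo g K)
applyUpTo-LexLt ρ {K = suc K} {zero}  _         _     ft≺gt = here ft≺gt
applyUpTo-LexLt ρ {f} {g} {suc K} {suc t} (s<s t<K) agree ft≺gt =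
  subst (λ a → LexLt ρ (applyUpTo f (suc K)) (a ∷ applyUpTo (g ∘ suc) K)) (agree z<s)
        (there (applyUpTo-LexLt ρ t<K (agree ∘ s<s) ft≺gt))

InjectiveBelow : ∀ {A : Set} → ℕ → (ℕ → A) → Set
InjectiveBelow n π = ∀ {s t} → s < n → t < n → π s ≡ π t → s ≡ t

injective⇒surjective : ∀ {n} {φ : Fin n → Fin n} → Injective _≡_ _≡_ φ → ∀ y → ∃[ x ] φ x ≡ y
injective⇒surjective {suc n} {φ} φ-inj y with any? (λ x → φ x ≟ᶠ y)
... | yes hit = hit
... | no miss = ⊥-elim (1+n≰n (injective⇒≤ avoid-y-injective))
  where
  avoid-y : Fin (suc n) → Fin n
  avoid-y x = punchOut {i = y} {j = φ x} (λ y≡φx → miss (x , sym y≡φx))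
  avoid-y-injective : Injective _≡_ _≡_ avoid-y
  avoid-y-injective {a} {b} eq =
    φ-inj (punchOut-injective (λ y≡φa → miss (a , sym y≡φa)) (λ y≡φb → miss (b , sym y≡φb)) eq)

rankingOrder : ∀ {n} (φ : Fin n → Fin n) → Injective _≡_ _≡_ φ → Order n
rankingOrder φ φ-inj = mk↔ₛ′ (proj₁ ∘ preimage) φ (λ x → φ-inj (proj₂ (preimage (φ x)))) (proj₂ ∘ preimage)
  where preimage = injective⇒surjective φ-inj

first-difference : ∀ {n} (f g : ℕ → Fin n) {k} → f k ≢ g k →
                   ∃[ t ] t ≤ k × f t ≢ g t × (∀ {s} → s < t → f s ≡ g s)
first-difference f g {zero} fk≢gk = 0 , z≤n , fk≢gk , λ ()
first-difference f g {suc k} fk≢gk with f 0 ≟ᶠ g 0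
... | no f0≢g0 = 0 , z≤n , f0≢g0 , λ ()
... | yes f0≡g0 with t , t≤k , ft≢gt , agree ← first-difference (f ∘ suc) (g ∘ suc) fk≢gk =
  suc t , s≤s t≤k , ft≢gt , λ { {zero} _ → f0≡g0 ; {suc _} (s<s s<t) → agree s<t }

second-difference : ∀ {n} {π σ : ℕ → Fin n} → InjectiveBelow n π → (∀ y → ∃[ t ] t < n × σ t ≡ y) →
                    ∀ {k} → k < n → π k ≢ σ k → ∃[ k′ ] k′ < n × k′ ≢ k × π k′ ≢ σ k′
second-difference {π = π} {σ} π-inj σ-surj {k} k<n πk≢σk with k′ , k′<n , σk′≡πk ← σ-surj (π k) =
  k′ , k′<n , k′≢k , λ πk′≡σk′ → k′≢k (π-inj k′<n k<n (trans πk′≡σk′ σk′≡πk))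
  where
  k′≢k : k′ ≢ k
  k′≢k refl = πk≢σk (sym σk′≡πk)

window : ∀ {m} → (ℕ → Fin (suc m)) → (ℕ → Fin (suc m)) → ℕ → ℕ → Fin (suc m)
window {m} letter missing p t with t <? m
... | yes _ = letter (p + t)
... | no _  = missing p

module _ {m} {letter missing : ℕ → Fin (suc m)} where

  window-letter : ∀ p {t} → t < m → window letter missing p t ≡ letter (p + t)
  window-letter p {t} t<m with t <? m
  ... | yes _   = refl
  ... | no t≮m = contradiction t<m t≮m

  window-missing : ∀ p {t} → m ≤ t → window letter missing p t ≡ missing p
  window-missing p {t} m≤t with t <? m
  ... | yes t<m = contradiction m≤t (<⇒≱ t<m)
  ... | no _    = refl

-- A shorthand universal cycle for the permutations of suc m letters, unrolled periodically:
-- window p lists the m letters from position p followed by the letter they miss.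
record ShorthandUniversalCycle (m : ℕ) : Set where
  field
    letter missing   : ℕ → Fin (suc m)
    letter-periodic  : Periodic (suc m !) letter
    missing-periodic : Periodic (suc m !) missing
    window-injective : ∀ p → InjectiveBelow (suc m) (window letter missing p)
    windows-distinct : ∀ p j → 0 < j → j < suc m ! →
                       ∃[ t ] t < suc m × window letter missing p t ≢ window letter missing (p + j) t

  window-periodic : ∀ p t → window letter missing (p + suc m !) t ≡ window letter missing p t
  window-periodic p t with t <? m
  ... | yes _ = trans (cong letter (xy∙z≈xz∙y p (suc m !) t)) (letter-periodic (p + t))
  ... | no _  = missing-periodic p

  window-shift : ∀ p {s} → suc s < m → window letter missing (suc p) s ≡ window letter missing p (suc s)
  window-shift p {s} 1+s<m = begin
    window letter missing (suc p) s  ≡⟨ window-letter (suc p) (<-trans (n<1+n s) 1+s<m) ⟩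
    letter (suc p + s)               ≡⟨ cong letter (+-suc p s) ⟨
    letter (p + suc s)               ≡⟨ window-letter p 1+s<m ⟨
    window letter missing p (suc s)  ∎
    where open ≡-Reasoning

module _ {m} (C : ShorthandUniversalCycle m) where
  open ShorthandUniversalCycle C

  private
    N : ℕ
    N = suc m !

    perm : ℕ → ℕ → Fin (suc m)
    perm = window letter missing

    windowOrder : ℕ → Order (suc m)
    windowOrder i =
      rankingOrder (perm i ∘ toℕ) (λ eq → toℕ-injective (window-injective i (toℕ<n _) (toℕ<n _) eq))

    rank : ℕ → Fin (suc m) → ℕ
    rank i x = toℕ (Inverse.to (windowOrder i) x)

    rank-window : ∀ i {t} → t < suc m → rank i (perm i t) ≡ t
    rank-window i {t} t<1+m = begin
      rank i (perm i t)                        ≡⟨ cong (rank i ∘ perm i) (toℕ-fromℕ< t<1+m) ⟨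
      rank i (perm i (toℕ (fromℕ< t<1+m)))     ≡⟨ cong toℕ (Inverse.strictlyInverseˡ (windowOrder i) _) ⟩
      toℕ (fromℕ< t<1+m)                       ≡⟨ toℕ-fromℕ< t<1+m ⟩
      t                                        ∎
      where open ≡-Reasoning

    window-rank : ∀ i x → perm i (rank i x) ≡ x
    window-rank i = Inverse.strictlyInverseʳ (windowOrder i)

    letters-differ : ∀ {i i′ t} → t < m → perm i t ≢ perm i′ t → letter (i + t) ≢ letter (i′ + t)
    letters-differ {i} {i′} t<m differ eq =
      differ (trans (window-letter i t<m) (trans eq (sym (window-letter i′ t<m))))

    difference-before-missing : ∀ i {j} → 0 < j → j < N → ∃[ t ] t < m × letter (i + t) ≢ letter (i + j + t)
    difference-before-missing i {j} 0<j j<N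
      with k , k<1+m , perms-differ ← windows-distinct i j 0<j j<N
      with k′ , k′<1+m , k′≢k , perms-differ′ ←
           second-difference (window-injective i) (λ y → rank (i + j) y , toℕ<n _ , window-rank (i + j) y)
                             k<1+m perms-differ
      with k ≟ m
    ... | no k≢m    = let k<m = ≤∧≢⇒< (s≤s⁻¹ k<1+m) k≢m in k , k<m , letters-differ k<m perms-differ
    ... | yes refl = let k′<m = ≤∧≢⇒< (s≤s⁻¹ k′<1+m) k′≢k in k′ , k′<m , letters-differ k′<m perms-differ′

    -- Below the first difference both words spell perm i 0, …, perm i (t-1); by injectivity of
    -- perm (i + j) its t-th letter is none of these, so its rank exceeds t.
    first-difference-ascends : ∀ i j {t} → t < m → (∀ {s} → s < t → letter (i + s) ≡ letter (i + j + s)) →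
                               letter (i + t) ≢ letter (i + j + t) →
                               letter (i + t) ≺[ windowOrder i ] letter (i + j + t)
    first-difference-ascends i j {t} t<m agree differ = subst (_< u) (sym rank-t) t<u
      where
      x : Fin (suc m)
      x = letter (i + j + t)
      u : ℕ
      u = rank i x
      rank-t : rank i (letter (i + t)) ≡ t
      rank-t = trans (cong (rank i) (sym (window-letter i t<m))) (rank-window i (m<n⇒m<1+n t<m))
      t<u : t < u
      t<u with <-cmp t u
      ... | tri< t<u _ _  = t<u
      ... | tri≈ _ t≡u _  =
        contradiction (trans (sym (window-letter i t<m)) (trans (cong (perm i) t≡u) (window-rank i x))) differ
      ... | tri> _ _ u<t  =
        contradiction (window-injective (i + j) (m<n⇒m<1+n u<m) (m<n⇒m<1+n t<m) same) (<⇒≢ u<t)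
        where
        open ≡-Reasoning
        u<m : u < m
        u<m = <-trans u<t t<m
        same : perm (i + j) u ≡ perm (i + j) t
        same = begin
          perm (i + j) u       ≡⟨ window-letter (i + j) u<m ⟩
          letter (i + j + u)   ≡⟨ agree u<t ⟨
          letter (i + u)       ≡⟨ window-letter i u<m ⟨
          perm i u             ≡⟨ window-rank i x ⟩
          x                    ≡⟨ window-letter (i + j) t<m ⟨
          perm (i + j) t       ∎

    conjugates-ascend : ∀ i {j} → 0 < j → j < N →
                        LexLt (windowOrder i) (applyUpTo (letter ∘ (i +_)) N)
                                              (applyUpTo (letter ∘ (i + j +_)) N)
    conjugates-ascend i {j} 0<j j<N
      with k , k<m , differ-k ← difference-before-missing i 0<j j<N
      with t , t≤k , differ , agree ← first-difference (letter ∘ (i +_)) (letter ∘ (i + j +_)) differ-k =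
      applyUpTo-LexLt (windowOrder i) (<-trans t<m m<N) agree (first-difference-ascends i j t<m agree differ)
      where
      t<m : t < m
      t<m = ≤-<-trans t≤k k<m
      m<N : m < N
      m<N = <-≤-trans (n<1+n m) (m≤m*n (suc m) (m !) {{m !≢0}})

  shorthandCycle⇒universalLyndon : Σ (Word (suc m)) (IsUniversalLyndon (suc m))
  shorthandCycle⇒universalLyndon =
    word , length-word , λ i i<len → windowOrder i , minimal (subst (i <_) length-word i<len)
    where
    word : Word (suc m)
    word = applyUpTo letter N
    length-word : length word ≡ N
    length-word = length-applyUpTo letter N
    minimal : ∀ {i} → i < N → SmallerThanProperConjugates (windowOrder i) (conjugate word i)
    minimal {i} i<N a w₁ b w₂ eq =
      subst₂ (LexLt (windowOrder i)) (sym conjugate≡) (sym rotation≡) (conjugates-ascend i z<s j<N)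
      where
      conjugate≡ : conjugate word i ≡ applyUpTo (letter ∘ (i +_)) N
      conjugate≡ = conjugate-applyUpTo letter-periodic (<⇒≤ i<N)
      j : ℕ
      j = length (a ∷ w₁)
      rotation≡ : (b ∷ w₂) ++ (a ∷ w₁) ≡ applyUpTo (letter ∘ (i + j +_)) N
      rotation≡ = trans (rotate-applyUpTo (periodic-shift letter-periodic i) (a ∷ w₁) (b ∷ w₂)
                                          (trans (sym conjugate≡) eq))
                        (applyUpTo-cong (λ t → cong letter (sym (+-assoc i j t))) N)
      j<N : j < N
      j<N = subst (j <_) (trans (sym (length-++ (a ∷ w₁))) (trans (cong length (sym eq))
                         (trans (cong length conjugate≡) (length-applyUpTo _ N))))
                  (m<m+n j z<s)

module Extension {m} (C : ShorthandUniversalCycle m) where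
  open ShorthandUniversalCycle C

  k : ℕ
  k = suc m

  n : ℕ
  n = suc k

  perm : ℕ → ℕ → Fin k
  perm = window letter missing

  new : Fin n
  new = fromℕ k

  block : ℕ → ℕ → Fin n
  block i zero    = new
  block i (suc c) = inject₁ (perm i c)

  block-periodic : ∀ i c → block (i + k !) c ≡ block i c
  block-periodic i zero    = refl
  block-periodic i (suc c) = cong inject₁ (window-periodic i c)

  block-injective : ∀ i → InjectiveBelow n (block i)
  block-injective i {zero}  {zero}  _ _ _  = refl
  block-injective i {zero}  {suc _} _ _ eq = contradiction eq fromℕ≢inject₁
  block-injective i {suc _} {zero}  _ _ eq = contradiction (sym eq) fromℕ≢inject₁
  block-injective i {suc _} {suc _} (s<s c<k) (s<s c′<k) eq =
    cong suc (window-injective i c<k c′<k (inject₁-injective eq))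

  -- The window starting at offset r < n of block i reads its t-th letter from offset origin r t
  -- of block i: past the end of the block it reads block (suc i) = new ∷ perm i ∘ suc, and its
  -- missing letter is perm i 0, or new if r = 1.
  origin : ℕ → ℕ → ℕ
  origin r t with <-cmp (r + t) n
  ... | tri< _ _ _ = r + t
  ... | tri≈ _ _ _ = 0
  ... | tri> _ _ _ with t <? k
  ...   | yes _ = suc (suc (r + t ∸ suc n))
  ...   | no _  = 1

  origin-inside : ∀ r t → r + t < n → origin r t ≡ r + t
  origin-inside r t r+t<n with <-cmp (r + t) n
  ... | tri< _ _ _     = refl
  ... | tri≈ r+t≮n _ _ = contradiction r+t<n r+t≮n
  ... | tri> r+t≮n _ _ = contradiction r+t<n r+t≮n

  origin-boundary : ∀ r t → r + t ≡ n → origin r t ≡ 0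
  origin-boundary r t r+t≡n with <-cmp (r + t) n
  ... | tri< _ r+t≢n _ = contradiction r+t≡n r+t≢n
  ... | tri≈ _ _ _     = refl
  ... | tri> _ r+t≢n _ = contradiction r+t≡n r+t≢n

  origin-next : ∀ r t → n < r + t → t < k → origin r t ≡ suc (suc (r + t ∸ suc n))
  origin-next r t n<r+t t<k with <-cmp (r + t) n
  ... | tri< _ _ n≮r+t = contradiction n<r+t n≮r+t
  ... | tri≈ _ _ n≮r+t = contradiction n<r+t n≮r+t
  ... | tri> _ _ _ with t <? k
  ...   | yes _  = refl
  ...   | no t≮k = contradiction t<k t≮k

  origin-missing : ∀ r t → n < r + t → k ≤ t → origin r t ≡ 1
  origin-missing r t n<r+t k≤t with <-cmp (r + t) n
  ... | tri< _ _ n≮r+t = contradiction n<r+t n≮r+t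
  ... | tri≈ _ _ n≮r+t = contradiction n<r+t n≮r+t
  ... | tri> _ _ _ with t <? k
  ...   | yes t<k = contradiction k≤t (<⇒≱ t<k)
  ...   | no _    = refl

  origin⁻¹ : ℕ → ℕ → ℕ
  origin⁻¹ r c with r ≤? c
  origin⁻¹ r c             | yes _ = c ∸ r
  origin⁻¹ r zero          | no _  = n ∸ r
  origin⁻¹ r (suc zero)    | no _  = k
  origin⁻¹ r (suc (suc c)) | no _  = n ∸ r + suc c

  origin⁻¹-inside : ∀ {r c} → r ≤ c → origin⁻¹ r c ≡ c ∸ r
  origin⁻¹-inside {r} {c} r≤c with r ≤? c
  ... | yes _  = refl
  ... | no r≰c = contradiction r≤c r≰c

  origin⁻¹-new : ∀ {r} → 0 < r → origin⁻¹ r 0 ≡ n ∸ r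
  origin⁻¹-new {r} 0<r with r ≤? 0
  ... | yes r≤0 = contradiction r≤0 (<⇒≱ 0<r)
  ... | no _    = refl

  origin⁻¹-missing : ∀ {r} → 1 < r → origin⁻¹ r 1 ≡ k
  origin⁻¹-missing {r} 1<r with r ≤? 1
  ... | yes r≤1 = contradiction r≤1 (<⇒≱ 1<r)
  ... | no _    = refl

  origin⁻¹-next : ∀ {r c} → suc (suc c) < r → origin⁻¹ r (suc (suc c)) ≡ n ∸ r + suc c
  origin⁻¹-next {r} {c} 2+c<r with r ≤? suc (suc c)
  ... | yes r≤2+c = contradiction r≤2+c (<⇒≱ 2+c<r)
  ... | no _      = refl

  next-offset<m : ∀ {r t} → r < n → t < k → n < r + t → suc (r + t ∸ suc n) < m
  next-offset<m {r} {t} r<n t<k n<r+t = +-cancelˡ-≤ m _ _ (begin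
    m + suc (suc e)    ≡⟨ +-suc m (suc e) ⟩
    suc (m + suc e)    ≡⟨ cong suc (+-suc m e) ⟩
    suc (suc (m + e))  ≤⟨ s≤s⁻¹ bound ⟩
    m + m              ∎)
    where
    open ≤-Reasoning
    e : ℕ
    e = r + t ∸ suc n
    bound : suc n + e ≤ k + m
    bound = subst (_≤ k + m) (sym (m+[n∸m]≡n n<r+t)) (+-mono-≤ (s≤s⁻¹ r<n) (s≤s⁻¹ t<k))

  next-origin<r : ∀ r {t} → n < r + t → t < k → suc (suc (r + t ∸ suc n)) < r
  next-origin<r r {t} n<r+t t<k = m+n≡o+p⇒n<o⇒p<m r+t≡k+origin t<k
    where
    r+t≡k+origin : r + t ≡ k + suc (suc (r + t ∸ suc n))
    r+t≡k+origin = trans (sym (m+[n∸m]≡n n<r+t)) (sym (trans (+-suc k _) (cong suc (+-suc k _))))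

  origin-< : ∀ {r t} → r < n → t < n → origin r t < n
  origin-< {r} {t} r<n t<n = by-cases (<-cmp (r + t) n) (t <? k)
    where
    by-cases : Tri (r + t < n) (r + t ≡ n) (n < r + t) → Dec (t < k) → origin r t < n
    by-cases (tri< r+t<n _ _) _         = subst (_< n) (sym (origin-inside r t r+t<n)) r+t<n
    by-cases (tri≈ _ r+t≡n _) _         = subst (_< n) (sym (origin-boundary r t r+t≡n)) z<s
    by-cases (tri> _ _ n<r+t) (yes t<k) =
      subst (_< n) (sym (origin-next r t n<r+t t<k)) (s<s (m<n⇒m<1+n (next-offset<m r<n t<k n<r+t)))
    by-cases (tri> _ _ n<r+t) (no t≮k)  = subst (_< n) (sym (origin-missing r t n<r+t (≮⇒≥ t≮k))) (s<s z<s)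

  origin⁻¹-< : ∀ {r c} → r < n → c < n → origin⁻¹ r c < n
  origin⁻¹-< {r} {c} r<n c<n = by-cases c c<n (r ≤? c)
    where
    by-cases : ∀ c → c < n → Dec (r ≤ c) → origin⁻¹ r c < n
    by-cases c c<n (yes r≤c) = subst (_< n) (sym (origin⁻¹-inside r≤c)) (≤-<-trans (m∸n≤m c r) c<n)
    by-cases zero _ (no r≰0) =
      subst (_< n) (sym (origin⁻¹-new (≰⇒> r≰0))) (∸-monoʳ-< (≰⇒> r≰0) (<⇒≤ r<n))
    by-cases (suc zero) _ (no r≰1) = subst (_< n) (sym (origin⁻¹-missing (≰⇒> r≰1))) (n<1+n k)
    by-cases (suc (suc c)) _ (no r≰2+c) =
      subst (_< n) (sym (origin⁻¹-next (≰⇒> r≰2+c)))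
            (subst (n ∸ r + suc c <_) (m∸n+n≡m (<⇒≤ r<n)) (+-monoʳ-< (n ∸ r) (<-trans (n<1+n _) (≰⇒> r≰2+c))))

  r+[n∸r+x]≡n+x : ∀ {r} x → r ≤ n → r + (n ∸ r + x) ≡ n + x
  r+[n∸r+x]≡n+x {r} x r≤n = trans (sym (+-assoc r (n ∸ r) x)) (cong (_+ x) (m+[n∸m]≡n r≤n))

  origin⁻¹-origin : ∀ {r t} → r < n → t < n → origin⁻¹ r (origin r t) ≡ t
  origin⁻¹-origin {r} {t} r<n t<n = by-cases (<-cmp (r + t) n) (t <? k)
    where
    open ≡-Reasoning
    by-cases : Tri (r + t < n) (r + t ≡ n) (n < r + t) → Dec (t < k) → origin⁻¹ r (origin r t) ≡ t
    by-cases (tri< r+t<n _ _) _ = begin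
      origin⁻¹ r (origin r t)  ≡⟨ cong (origin⁻¹ r) (origin-inside r t r+t<n) ⟩
      origin⁻¹ r (r + t)       ≡⟨ origin⁻¹-inside (m≤m+n r t) ⟩
      r + t ∸ r                ≡⟨ m+n∸m≡n r t ⟩
      t                        ∎
    by-cases (tri≈ _ r+t≡n _) _ = begin
      origin⁻¹ r (origin r t)  ≡⟨ cong (origin⁻¹ r) (origin-boundary r t r+t≡n) ⟩
      origin⁻¹ r 0             ≡⟨ origin⁻¹-new 0<r ⟩
      n ∸ r                    ≡⟨ cong (_∸ r) r+t≡n ⟨
      r + t ∸ r                ≡⟨ m+n∸m≡n r t ⟩
      t                        ∎
      where
      0<r : 0 < r
      0<r = n≢0⇒n>0 (λ { refl → <⇒≢ t<n r+t≡n })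
    by-cases (tri> _ _ n<r+t) (yes t<k) = begin
      origin⁻¹ r (origin r t)  ≡⟨ cong (origin⁻¹ r) (origin-next r t n<r+t t<k) ⟩
      origin⁻¹ r (suc (suc e)) ≡⟨ origin⁻¹-next (next-origin<r r n<r+t t<k) ⟩
      n ∸ r + suc e            ≡⟨ +-cancelˡ-≡ r _ _ (begin
        r + (n ∸ r + suc e)      ≡⟨ r+[n∸r+x]≡n+x (suc e) (<⇒≤ r<n) ⟩
        n + suc e                ≡⟨ +-suc n e ⟩
        suc n + e                ≡⟨ m+[n∸m]≡n n<r+t ⟩
        r + t                    ∎) ⟩
      t                        ∎
      where
      e : ℕ
      e = r + t ∸ suc n
    by-cases (tri> _ _ n<r+t) (no t≮k) = begin
      origin⁻¹ r (origin r t)  ≡⟨ cong (origin⁻¹ r) (origin-missing r t n<r+t k≤t) ⟩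
      origin⁻¹ r 1             ≡⟨ origin⁻¹-missing (+-cancelʳ-< k 1 r (subst (λ t → n < r + t) t≡k n<r+t)) ⟩
      k                        ≡⟨ t≡k ⟨
      t                        ∎
      where
      k≤t : k ≤ t
      k≤t = ≮⇒≥ t≮k
      t≡k : t ≡ k
      t≡k = ≤-antisym (s≤s⁻¹ t<n) k≤t

  origin-origin⁻¹ : ∀ {r c} → r < n → c < n → origin r (origin⁻¹ r c) ≡ c
  origin-origin⁻¹ {r} {c} r<n c<n = by-cases c c<n (r ≤? c)
    where
    open ≡-Reasoning
    by-cases : ∀ c → c < n → Dec (r ≤ c) → origin r (origin⁻¹ r c) ≡ c
    by-cases c c<n (yes r≤c) = begin
      origin r (origin⁻¹ r c)  ≡⟨ cong (origin r) (origin⁻¹-inside r≤c) ⟩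
      origin r (c ∸ r)         ≡⟨ origin-inside r (c ∸ r) (subst (_< n) (sym (m+[n∸m]≡n r≤c)) c<n) ⟩
      r + (c ∸ r)              ≡⟨ m+[n∸m]≡n r≤c ⟩
      c                        ∎
    by-cases zero _ (no r≰0) = begin
      origin r (origin⁻¹ r 0)  ≡⟨ cong (origin r) (origin⁻¹-new (≰⇒> r≰0)) ⟩
      origin r (n ∸ r)         ≡⟨ origin-boundary r (n ∸ r) (m+[n∸m]≡n (<⇒≤ r<n)) ⟩
      0                        ∎
    by-cases (suc zero) _ (no r≰1) = begin
      origin r (origin⁻¹ r 1)  ≡⟨ cong (origin r) (origin⁻¹-missing (≰⇒> r≰1)) ⟩
      origin r k               ≡⟨ origin-missing r k (+-monoˡ-< k (≰⇒> r≰1)) ≤-refl ⟩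
      1                        ∎
    by-cases (suc (suc c)) _ (no r≰2+c) = begin
      origin r (origin⁻¹ r (suc (suc c)))  ≡⟨ cong (origin r) (origin⁻¹-next (≰⇒> r≰2+c)) ⟩
      origin r t                           ≡⟨ origin-next r t n<r+t t<k ⟩
      suc (suc (r + t ∸ suc n))            ≡⟨ cong (λ x → suc (suc (x ∸ suc n))) (trans r+t≡n+1+c (+-suc n c)) ⟩
      suc (suc (suc n + c ∸ suc n))        ≡⟨ cong (suc ∘ suc) (m+n∸m≡n (suc n) c) ⟩
      suc (suc c)                          ∎
      where
      t : ℕ
      t = n ∸ r + suc c
      r+t≡n+1+c : r + t ≡ n + suc c
      r+t≡n+1+c = r+[n∸r+x]≡n+x (suc c) (<⇒≤ r<n)
      n<r+t : n < r + t
      n<r+t = subst (n <_) (sym r+t≡n+1+c) (m<m+n n z<s)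
      t<k : t < k
      t<k = m+n≡o+p⇒n<o⇒p<m (trans (+-suc k (suc c)) (sym r+t≡n+1+c)) (≰⇒> r≰2+c)

  origin⁻¹-new-injective : ∀ {r r′} → r < n → r′ < n → origin⁻¹ r 0 ≡ origin⁻¹ r′ 0 → r ≡ r′
  origin⁻¹-new-injective {zero}  {zero}   _   _    _  = refl
  origin⁻¹-new-injective {zero}  {suc s′} _   r′<n eq =
    contradiction (trans eq (origin⁻¹-new {suc s′} z<s)) (<⇒≢ (m<n⇒0<n∸m r′<n))
  origin⁻¹-new-injective {suc s} {zero}   r<n _    eq =
    contradiction (trans (sym eq) (origin⁻¹-new {suc s} z<s)) (<⇒≢ (m<n⇒0<n∸m r<n))
  origin⁻¹-new-injective {suc s} {suc s′} r<n r′<n eq =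
    ∸-cancelˡ-≡ (<⇒≤ r<n) (<⇒≤ r′<n)
                (trans (sym (origin⁻¹-new {suc s} z<s)) (trans eq (origin⁻¹-new {suc s′} z<s)))

  letter⁺ : ℕ → Fin n
  letter⁺ x = block (x / n) (x % n)

  missing⁺ : ℕ → Fin n
  missing⁺ x = block (x / n) (origin (x % n) k)

  window⁺ : ℕ → ℕ → Fin n
  window⁺ = window letter⁺ missing⁺

  /-block : ∀ {c} i → c < n → (c + i * n) / n ≡ i
  /-block {c} i c<n = trans (+-distrib-/-∣ʳ c (n∣m*n i)) (cong₂ _+_ (m<n⇒m/n≡0 c<n) (m*n/n≡m i n))

  %-block : ∀ {c} i → c < n → (c + i * n) % n ≡ c
  %-block {c} i c<n = trans ([m+kn]%n≡m%n c i n) (m<n⇒m%n≡m c<n)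

  letter⁺-block : ∀ {c} i → c < n → letter⁺ (c + i * n) ≡ block i c
  letter⁺-block i c<n = cong₂ block (/-block i c<n) (%-block i c<n)

  missing⁺-block : ∀ {r} i → r < n → missing⁺ (r + i * n) ≡ block i (origin r k)
  missing⁺-block i r<n = cong₂ (λ i r → block i (origin r k)) (/-block i r<n) (%-block i r<n)

  shift-by-period : ∀ x → x + n ! ≡ x % n + (x / n + k !) * n
  shift-by-period x = begin
    x + n * k !                       ≡⟨ cong₂ _+_ (m≡m%n+[m/n]*n x n) (*-comm n (k !)) ⟩
    x % n + x / n * n + k ! * n       ≡⟨ +-assoc (x % n) _ _ ⟩
    x % n + (x / n * n + k ! * n)     ≡⟨ cong (x % n +_) (*-distribʳ-+ n (x / n) (k !)) ⟨
    x % n + (x / n + k !) * n         ∎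
    where open ≡-Reasoning

  letter⁺-periodic : Periodic (n !) letter⁺
  letter⁺-periodic x = trans (cong letter⁺ (shift-by-period x))
                             (trans (letter⁺-block (x / n + k !) (m%n<n x n)) (block-periodic (x / n) (x % n)))

  missing⁺-periodic : Periodic (n !) missing⁺
  missing⁺-periodic x = trans (cong missing⁺ (shift-by-period x))
                              (trans (missing⁺-block (x / n + k !) (m%n<n x n))
                                     (block-periodic (x / n) (origin (x % n) k)))

  letter⁺-ahead : ∀ {r t} i → r < n → t < k → letter⁺ (r + i * n + t) ≡ block i (origin r t)
  letter⁺-ahead {r} {t} i r<n t<k = by-cases (<-cmp (r + t) n)
    where
    open ≡-Reasoning
    position : r + i * n + t ≡ r + t + i * n
    position = xy∙z≈xz∙y r (i * n) t
    by-cases : Tri (r + t < n) (r + t ≡ n) (n < r + t) → letter⁺ (r + i * n + t) ≡ block i (origin r t)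
    by-cases (tri< r+t<n _ _) = begin
      letter⁺ (r + i * n + t)  ≡⟨ cong letter⁺ position ⟩
      letter⁺ (r + t + i * n)  ≡⟨ letter⁺-block i r+t<n ⟩
      block i (r + t)          ≡⟨ cong (block i) (origin-inside r t r+t<n) ⟨
      block i (origin r t)     ∎
    by-cases (tri≈ _ r+t≡n _) = begin
      letter⁺ (r + i * n + t)  ≡⟨ cong letter⁺ (trans position (cong (_+ i * n) r+t≡n)) ⟩
      letter⁺ (0 + suc i * n)  ≡⟨ letter⁺-block (suc i) z<s ⟩
      block i 0                ≡⟨ cong (block i) (origin-boundary r t r+t≡n) ⟨
      block i (origin r t)     ∎
    by-cases (tri> _ _ n<r+t) = begin
      letter⁺ (r + i * n + t)      ≡⟨ cong letter⁺ (trans position into-next-block) ⟩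
      letter⁺ (suc e + suc i * n)  ≡⟨ letter⁺-block (suc i) (m<n⇒m<1+n (m<n⇒m<1+n 1+e<m)) ⟩
      inject₁ (perm (suc i) e)     ≡⟨ cong inject₁ (window-shift i 1+e<m) ⟩
      block i (suc (suc e))        ≡⟨ cong (block i) (origin-next r t n<r+t t<k) ⟨
      block i (origin r t)         ∎
      where
      e : ℕ
      e = r + t ∸ suc n
      1+e<m : suc e < m
      1+e<m = next-offset<m r<n t<k n<r+t
      into-next-block : r + t + i * n ≡ suc e + suc i * n
      into-next-block = begin
        r + t + i * n        ≡⟨ cong (_+ i * n) (m+[n∸m]≡n n<r+t) ⟨
        suc n + e + i * n    ≡⟨ cong (_+ i * n) (trans (sym (+-suc n e)) (+-comm n (suc e))) ⟩
        suc e + n + i * n    ≡⟨ +-assoc (suc e) n (i * n) ⟩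
        suc e + suc i * n    ∎

  window⁺-block : ∀ {r t} i → r < n → t < n → window⁺ (r + i * n) t ≡ block i (origin r t)
  window⁺-block {r} {t} i r<n t<n = by-cases (t <? k)
    where
    by-cases : Dec (t < k) → window⁺ (r + i * n) t ≡ block i (origin r t)
    by-cases (yes t<k) = trans (window-letter (r + i * n) t<k) (letter⁺-ahead i r<n t<k)
    by-cases (no t≮k)  = trans (window-missing (r + i * n) (≮⇒≥ t≮k))
                               (trans (missing⁺-block i r<n) (cong (block i ∘ origin r) (sym t≡k)))
      where
      t≡k : t ≡ k
      t≡k = ≤-antisym (s≤s⁻¹ t<n) (≮⇒≥ t≮k)

  window⁺-shape : ∀ p {t} → t < n → window⁺ p t ≡ block (p / n) (origin (p % n) t)
  window⁺-shape p {t} t<n =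
    trans (cong (λ q → window⁺ q t) (m≡m%n+[m/n]*n p n)) (window⁺-block (p / n) (m%n<n p n) t<n)

  window⁺-at-origin⁻¹ : ∀ p {c} → c < n → window⁺ p (origin⁻¹ (p % n) c) ≡ block (p / n) c
  window⁺-at-origin⁻¹ p c<n = trans (window⁺-shape p (origin⁻¹-< (m%n<n p n) c<n))
                                    (cong (block (p / n)) (origin-origin⁻¹ (m%n<n p n) c<n))

  window⁺-injective : ∀ p → InjectiveBelow n (window⁺ p)
  window⁺-injective p {s} {t} s<n t<n eq = begin
    s                          ≡⟨ origin⁻¹-origin r<n s<n ⟨
    origin⁻¹ r (origin r s)    ≡⟨ cong (origin⁻¹ r) same-origin ⟩
    origin⁻¹ r (origin r t)    ≡⟨ origin⁻¹-origin r<n t<n ⟩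
    t                          ∎
    where
    open ≡-Reasoning
    r : ℕ
    r = p % n
    r<n : r < n
    r<n = m%n<n p n
    same-origin : origin r s ≡ origin r t
    same-origin = block-injective (p / n) (origin-< r<n s<n) (origin-< r<n t<n)
                    (trans (sym (window⁺-shape p s<n)) (trans eq (window⁺-shape p t<n)))

  offsets-differ : ∀ p q → p % n ≢ q % n → window⁺ p (origin⁻¹ (p % n) 0) ≢ window⁺ q (origin⁻¹ (p % n) 0)
  offsets-differ p q r≢r′ eq = r≢r′ (origin⁻¹-new-injective r<n r′<n (begin
    t                             ≡⟨ origin⁻¹-origin r′<n t<n ⟨
    origin⁻¹ r′ (origin r′ t)     ≡⟨ cong (origin⁻¹ r′) new-at-t ⟩
    origin⁻¹ r′ 0                 ∎))
    where
    open ≡-Reasoning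
    r : ℕ
    r = p % n
    r′ : ℕ
    r′ = q % n
    r<n : r < n
    r<n = m%n<n p n
    r′<n : r′ < n
    r′<n = m%n<n q n
    t : ℕ
    t = origin⁻¹ r 0
    t<n : t < n
    t<n = origin⁻¹-< r<n z<s
    new-at-t : origin r′ t ≡ 0
    new-at-t = block-injective (q / n) (origin-< r′<n t<n) z<s
                 (trans (sym (window⁺-shape q t<n)) (trans (sym eq) (window⁺-at-origin⁻¹ p z<s)))

  blocks-differ : ∀ p j′ {c} → c < k → perm (p / n) c ≢ perm (p / n + j′) c →
                  window⁺ p (origin⁻¹ (p % n) (suc c)) ≢ window⁺ (p + j′ * n) (origin⁻¹ (p % n) (suc c))
  blocks-differ p j′ {c} c<k differ eq = differ (inject₁-injective (begin
    inject₁ (perm (p / n) c)                              ≡⟨ window⁺-at-origin⁻¹ p (s<s c<k) ⟨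
    window⁺ p (origin⁻¹ (p % n) (suc c))                  ≡⟨ eq ⟩
    window⁺ q (origin⁻¹ (p % n) (suc c))
      ≡⟨ cong (λ r → window⁺ q (origin⁻¹ r (suc c))) ([m+kn]%n≡m%n p j′ n) ⟨
    window⁺ q (origin⁻¹ (q % n) (suc c))                  ≡⟨ window⁺-at-origin⁻¹ q (s<s c<k) ⟩
    inject₁ (perm (q / n) c)                              ≡⟨ cong (λ i → inject₁ (perm i c)) q/n≡ ⟩
    inject₁ (perm (p / n + j′) c)                         ∎))
    where
    open ≡-Reasoning
    q : ℕ
    q = p + j′ * n
    q/n≡ : q / n ≡ p / n + j′
    q/n≡ = trans (+-distrib-/-∣ʳ p (n∣m*n j′)) (cong (p / n +_) (m*n/n≡m j′ n))

  same-offset⇒whole-blocks : ∀ p j → p % n ≡ (p + j) % n → j ≡ ((p + j) / n ∸ p / n) * n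
  same-offset⇒whole-blocks p j same-offset = begin
    j                                ≡⟨ m+n∸m≡n (p / n * n) j ⟨
    p / n * n + j ∸ p / n * n        ≡⟨ cong (_∸ p / n * n) blocks ⟩
    (p + j) / n * n ∸ p / n * n      ≡⟨ *-distribʳ-∸ n ((p + j) / n) (p / n) ⟨
    ((p + j) / n ∸ p / n) * n        ∎
    where
    open ≡-Reasoning
    blocks : p / n * n + j ≡ (p + j) / n * n
    blocks = +-cancelˡ-≡ (p % n) _ _ (begin
      p % n + (p / n * n + j)        ≡⟨ +-assoc (p % n) _ j ⟨
      p % n + p / n * n + j          ≡⟨ cong (_+ j) (m≡m%n+[m/n]*n p n) ⟨
      p + j                          ≡⟨ m≡m%n+[m/n]*n (p + j) n ⟩
      (p + j) % n + (p + j) / n * n  ≡⟨ cong (_+ (p + j) / n * n) same-offset ⟨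
      p % n + (p + j) / n * n        ∎)

  whole-blocks-differ : ∀ p {j′} → 0 < j′ → j′ < k ! → ∃[ t ] t < n × window⁺ p t ≢ window⁺ (p + j′ * n) t
  whole-blocks-differ p {j′} 0<j′ j′<k! with c , c<k , differ ← windows-distinct (p / n) j′ 0<j′ j′<k! =
    origin⁻¹ (p % n) (suc c) , origin⁻¹-< (m%n<n p n) (s<s c<k) , blocks-differ p j′ c<k differ

  windows⁺-distinct : ∀ p j → 0 < j → j < n ! → ∃[ t ] t < n × window⁺ p t ≢ window⁺ (p + j) t
  windows⁺-distinct p j 0<j j<n! = by-cases (p % n ≟ (p + j) % n)
    where
    by-cases : Dec (p % n ≡ (p + j) % n) → ∃[ t ] t < n × window⁺ p t ≢ window⁺ (p + j) t
    by-cases (no r≢r′)  = origin⁻¹ (p % n) 0 , origin⁻¹-< (m%n<n p n) z<s , offsets-differ p (p + j) r≢r′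
    by-cases (yes r≡r′) = subst (λ j → ∃[ t ] t < n × window⁺ p t ≢ window⁺ (p + j) t) (sym j≡)
                                (whole-blocks-differ p 0<j′ j′<k!)
      where
      j′ : ℕ
      j′ = (p + j) / n ∸ p / n
      j≡ : j ≡ j′ * n
      j≡ = same-offset⇒whole-blocks p j r≡r′
      0<j′ : 0 < j′
      0<j′ = *-cancelʳ-< n 0 j′ (subst (0 <_) j≡ 0<j)
      j′<k! : j′ < k !
      j′<k! = *-cancelʳ-< n j′ (k !) (subst₂ _<_ j≡ (*-comm n (k !)) j<n!)

extend : ∀ {m} → ShorthandUniversalCycle m → ShorthandUniversalCycle (suc m)
extend C = record
  { letter           = letter⁺
  ; missing          = missing⁺
  ; letter-periodic  = letter⁺-periodic
  ; missing-periodic = missing⁺-periodic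
  ; window-injective = window⁺-injective
  ; windows-distinct = windows⁺-distinct
  }
  where open Extension C

trivialCycle : ShorthandUniversalCycle 0
trivialCycle = record
  { letter           = λ _ → fzero
  ; missing          = λ _ → fzero
  ; letter-periodic  = λ _ → refl
  ; missing-periodic = λ _ → refl
  ; window-injective = λ { _ (s≤s z≤n) (s≤s z≤n) _ → refl }
  ; windows-distinct = λ _ _ 0<j j<1 → contradiction (s≤s⁻¹ j<1) (<⇒≱ 0<j)
  }

shorthandUniversalCycle : ∀ m → ShorthandUniversalCycle m
shorthandUniversalCycle zero    = trivialCycle
shorthandUniversalCycle (suc m) = extend (shorthandUniversalCycle m)

proposition2 : (n : ℕ) → 0 < n → Σ (Word n) (IsUniversalLyndon n)
proposition2 (suc m) _ = shorthandCycle⇒universalLyndon (shorthandUniversalCycle m)
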